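{- A queue behavior $b$ is legal if and only if $b$ has a sequential witness.
   Context: A queue event is a tuple $(u,m,d_{in},d_{out})$ with a globally unique identifier $u\in\mathbb{N}$ and method $m\in\{\mathtt{enq},\mathtt{deq}\}$; an enqueue event of value $x\in\mathbb{N}$ is $\mathtt{enq}^u(x)=(u,\mathtt{enq},x,\bot)$ and a dequeue event returning $x\in\mathbb{N}\cup\{\mathtt{NULL}\}$ is $\mathtt{deq}^u(x)=(u,\mathtt{deq},\bot,x)$ ($\mathtt{NULL}\notin\mathbb{N}$). A queue behavior is a finite duplicate-free sequence of queue events. The labelled transition system $\mathsf{LTS}_Q$ has as states finite sequences over $\mathbb{N}$, initial state the empty sequence $\varepsilon$, and transitions $q\xrightarrow{\mathtt{enq}(x)}q\cdot x$, $x\cdot q'\xrightarrow{\mathtt{deq}(x)}q'$ for $x\in\mathbb{N}$, and $\varepsilon\xrightarrow{\mathtt{deq}(\mathtt{NULL})}\varepsilon$ (identifiers are ignored by transitions). A behavior is legal if it is the sequence of labels of some run of $\mathsf{LTS}_Q$ from $\varepsilon$. For a behavior $b$: $\mathrm{Enq}(b)$, $\mathrm{Deq}(b)$ are its enqueue and dequeue events, $\mathrm{Val}(b,e)$ is the value enqueued or returned by $e$, and $e\prec_b e'$ means $e$ occurs before $e'$ in $b$. A sequential witness for $b$ is a total map $\mu:\mathrm{Deq}(b)\to\mathrm{Enq}(b)\cup\{\bot\}$ such that: (i) $\mu(d)=e$ implies $\mathrm{Val}(b,d)=\mathrm{Val}(b,e)$; (ii) $\mu(d)=\bot$ iff $\mathrm{Val}(b,d)=\mathtt{NULL}$;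 (iii) $\mu(d)=\mu(d')\neq\bot$ implies $d=d'$; (iv) $\mu(d)=e$ implies $e\prec_b d$; (v) if $e\prec_b\mu(d')$ then there is $d$ with $\mu(d)=e$ and $d\prec_b d'$; (vi) $\mu(d)=\bot$ implies $|\{e\in\mathrm{Enq}(b)\mid e\prec_b d\}|=|\{d'\in\mathrm{Deq}(b)\mid d'\prec_b d,\ \mu(d')\neq\bot\}|$. -}

module Defs where

open import Data.Nat using (ℕ)
open import Data.Bool using (Bool; true; false; _∧_) renaming (_≟_ to _≟ᵇ_)
open import Data.Maybe using (Maybe; just; nothing; is-just)
open import Data.List using (List; []; _∷_; _++_; [_]; length; map; filter)
open import Data.List.Membership.Propositional using (_∈_)
open import Data.List.Relation.Unary.Unique.Propositional using (Unique)
open import Data.Product using (Σ; ∃; ∃-syntax; _×_; _,_)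
open import Relation.Binary.PropositionalEquality using (_≡_; _≢_)
open import Relation.Nullary using (Dec; yes; no)
open import Relation.Nullary.Decidable using (⌊_⌋)
open import Function.Bundles using (_⇔_)

-- Queue events.  enq u x = (u, enq, x, ⊥);  deq u r = (u, deq, ⊥, r),
-- where r : Maybe ℕ and  nothing  plays the role of NULL.
data Event : Set where
  enq : (u : ℕ) (x : ℕ) → Event
  deq : (u : ℕ) (r : Maybe ℕ) → Event

uid : Event → ℕ
uid (enq u _) = u
uid (deq u _) = u

isEnq : Event → Bool
isEnq (enq _ _) = true
isEnq (deq _ _) = false

isDeq : Event → Bool
isDeq (enq _ _) = false
isDeq (deq _ _) = true

Val : Event → Maybe ℕ
Val (enq _ x) = just x
Val (deq _ r) = r

Behavior : Set
Behavior = List Event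

QueueBehavior : Behavior → Set
QueueBehavior b = Unique (map uid b)

_≺[_]_ : Event → Behavior → Event → Set
e ≺[ b ] e' = ∃[ b₁ ] ∃[ b₂ ] ∃[ b₃ ] (b ≡ b₁ ++ (e ∷ b₂) ++ (e' ∷ b₃))

data Step : List ℕ → Event → List ℕ → Set where
  step-enq     : ∀ {q u x} → Step q (enq u x) (q ++ [ x ])
  step-deq     : ∀ {q u x} → Step (x ∷ q) (deq u (just x)) q
  step-deqNull : ∀ {u} → Step [] (deq u nothing) []

data Run : List ℕ → Behavior → List ℕ → Set where
  done : ∀ {q} → Run q [] q
  next : ∀ {q q' q'' e b} → Step q e q' → Run q' b q'' → Run q (e ∷ b) q''

Legal : Behavior → Set
Legal b = ∃[ q ] Run [] b q

-- A sequential witness for b.  μ is a map on events; only its values on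
-- Deq(b) matter, and it is required to land in Enq(b) ∪ {⊥} there
-- (⊥ is represented by  nothing ).
record SequentialWitness (b : Behavior) (μ : Event → Maybe Event) : Set where
  field
    into  : ∀ d e → d ∈ b → isDeq d ≡ true → μ d ≡ just e →
              e ∈ b × isEnq e ≡ true
    w-i : ∀ d e → d ∈ b → isDeq d ≡ true → μ d ≡ just e → Val d ≡ Val e
    w-ii : ∀ d → d ∈ b → isDeq d ≡ true → (μ d ≡ nothing ⇔ Val d ≡ nothing)
    w-iii : ∀ d d' e → d ∈ b → isDeq d ≡ true → d' ∈ b → isDeq d' ≡ true →
              μ d ≡ just e → μ d' ≡ just e → d ≡ d'
    w-iv : ∀ d e → d ∈ b → isDeq d ≡ true → μ d ≡ just e → e ≺[ b ] d
    w-v : ∀ e d' e' → e ∈ b → isEnq e ≡ true → d' ∈ b → isDeq d' ≡ true →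
              μ d' ≡ just e' → e ≺[ b ] e' →
              ∃[ d ] (d ∈ b × isDeq d ≡ true × μ d ≡ just e × d ≺[ b ] d')
    -- counting over the (unique) prefix of b preceding d
    w-vi : ∀ d b₁ b₂ → isDeq d ≡ true → b ≡ b₁ ++ d ∷ b₂ → μ d ≡ nothing →
              length (filter (λ e → isEnq e ≟ᵇ true) b₁)
              ≡ length (filter (λ d' → (isDeq d' ∧ is-just (μ d')) ≟ᵇ true) b₁)

HasSequentialWitness : Behavior → Set
HasSequentialWitness b = ∃[ μ ] SequentialWitness b μ

-- Run the queue on events instead of values: an enqueue appends its event, a dequeue drops the
-- head, and the LTS state after a prefix is the list of values of the events left pending.  So a
-- behavior is legal iff every dequeue returns the value of the head pending just before it.  The
-- canonical matching, sending each dequeue to that head, is then a sequential witness.  Conversely,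
-- along the behavior the enqueues seen so far split into those already served by μ and the pending
-- queue; (vi) says μ d = ⊥ only when this queue is empty, and (iii)-(v) that otherwise μ d is its
-- head.  So every witness is the canonical matching, and (i)-(ii) make the dequeues return heads.
module Submission where

open import Defs
open import Function using (_∘_; id)
open import Function.Bundles using (_⇔_; mk⇔; Equivalence)
open import Data.Nat using (ℕ; _+_)
open import Data.Nat.Properties using (+-assoc; +-identityʳ; +-cancelˡ-≡) renaming (_≟_ to _≟ℕ_)
open import Data.Bool using (Bool; true; false; _∧_) renaming (_≟_ to _≟ᵇ_)
open import Data.Maybe as Maybe using (Maybe; just; nothing; is-just)
open import Data.Maybe.Properties using (just-injective)
open import Data.List using (List; []; _∷_; _++_; [_]; _∷ʳ_; length; map; filter; foldl; head; take; drop)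
open import Data.List.Properties using (++-assoc; ++-identityʳ; map-++; length-++; foldl-++; filter-++; filter-accept; take++drop≡id; ∷-injective)
open import Data.List.Membership.Propositional using (_∈_; _∉_)
open import Data.List.Membership.Propositional.Properties using (∈-∃++; ∈-++⁻; ∈-++⁺ˡ; ∈-++⁺ʳ; ∈-filter⁻; ∈-filter⁺; ∈-map⁺)
open import Data.List.Relation.Unary.Any using (here; there)
open import Data.List.Relation.Unary.All as All using (All; []; _∷_)
open import Data.List.Relation.Unary.All.Properties using (++⁺; ++⁻ˡ)
open import Data.List.Relation.Unary.AllPairs using ([]; _∷_)
open import Data.List.Relation.Unary.Unique.Propositional using (Unique)
open import Data.List.Relation.Unary.Unique.Propositional.Properties using (map⁻; filter⁺)
open import Data.List.Reverse using (Reverse; reverseView; []; _∶_∶ʳ_)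
open import Data.Product using (map₁; ∃-syntax; ∃₂; _×_; _,_; proj₁; proj₂)
open import Data.Sum using (_⊎_; inj₁; inj₂; [_,_]′)
open import Data.Empty using (⊥; ⊥-elim)
open import Relation.Binary.PropositionalEquality using (_≡_; refl; sym; trans; cong; cong₂; subst; module ≡-Reasoning)
open import Relation.Nullary using (¬_; yes; no; does)
open import Relation.Unary using (Decidable)

-- Uniqueness and precedence

module _ {A : Set} where

  Unique-++⁻ˡ : ∀ (xs : List A) {ys} → Unique (xs ++ ys) → Unique xs
  Unique-++⁻ˡ []       _          = []
  Unique-++⁻ˡ (x ∷ xs) (x∉ ∷ xs!) = ++⁻ˡ xs x∉ ∷ Unique-++⁻ˡ xs xs!

  Unique-++⁻ʳ : ∀ (xs : List A) {ys} → Unique (xs ++ ys) → Unique ys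
  Unique-++⁻ʳ []       ys!       = ys!
  Unique-++⁻ʳ (x ∷ xs) (_ ∷ xs!) = Unique-++⁻ʳ xs xs!

  Unique-++⇒disjoint : ∀ (xs : List A) {ys v} → Unique (xs ++ ys) → v ∈ xs → v ∉ ys
  Unique-++⇒disjoint (x ∷ xs) (x∉ ∷ _)  (here refl)  v∈ys = All.lookup x∉ (∈-++⁺ʳ xs v∈ys) refl
  Unique-++⇒disjoint (x ∷ xs) (_ ∷ xs!) (there v∈xs)      = Unique-++⇒disjoint xs xs! v∈xs

  Unique-++∷⇒∉ : ∀ (xs : List A) {v ys} → Unique (xs ++ v ∷ ys) → v ∉ xs
  Unique-++∷⇒∉ xs xs! v∈xs = Unique-++⇒disjoint xs xs! v∈xs (here refl)

  ++-∷-cancelˡ : ∀ (xs xs′ : List A) {v ys ys′} → v ∉ xs → v ∉ xs′ →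
                 xs ++ v ∷ ys ≡ xs′ ++ v ∷ ys′ → xs ≡ xs′
  ++-∷-cancelˡ []       []         _  _   _  = refl
  ++-∷-cancelˡ []       (w ∷ xs′)  _  v∉′ eq with refl ← proj₁ (∷-injective eq) = ⊥-elim (v∉′ (here refl))
  ++-∷-cancelˡ (w ∷ xs) []         v∉ _   eq with refl ← proj₁ (∷-injective eq) = ⊥-elim (v∉ (here refl))
  ++-∷-cancelˡ (w ∷ xs) (w′ ∷ xs′) v∉ v∉′ eq with refl , eq′ ← ∷-injective eq =
    cong (w ∷_) (++-∷-cancelˡ xs xs′ (v∉ ∘ there) (v∉′ ∘ there) eq′)

  ∷ʳ-≡-++∷ : ∀ (xs ys : List A) {v w zs} → xs ∷ʳ v ≡ ys ++ w ∷ zs →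
             (ys ≡ xs × w ≡ v) ⊎ ∃[ zs′ ] (xs ≡ ys ++ w ∷ zs′)
  ∷ʳ-≡-++∷ []       []           refl = inj₁ (refl , refl)
  ∷ʳ-≡-++∷ []       (_ ∷ [])     ()
  ∷ʳ-≡-++∷ []       (_ ∷ _ ∷ _)  ()
  ∷ʳ-≡-++∷ (x ∷ xs) []           eq with refl , _ ← ∷-injective eq = inj₂ (xs , refl)
  ∷ʳ-≡-++∷ (x ∷ xs) (y ∷ ys)     eq with refl , eq′ ← ∷-injective eq with ∷ʳ-≡-++∷ xs ys eq′
  ... | inj₁ (refl , refl) = inj₁ (refl , refl)
  ... | inj₂ (zs′ , refl)  = inj₂ (zs′ , refl)

≺⇒∈ˡ : ∀ {b x y} → x ≺[ b ] y → x ∈ b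
≺⇒∈ˡ (b₁ , _ , _ , refl) = ∈-++⁺ʳ b₁ (here refl)

≺-∷ : ∀ {b x y} w → x ≺[ b ] y → x ≺[ w ∷ b ] y
≺-∷ w (b₁ , b₂ , b₃ , refl) = w ∷ b₁ , b₂ , b₃ , refl

≺-++ʳ : ∀ {b x y} c → x ≺[ b ] y → x ≺[ b ++ c ] y
≺-++ʳ {x = x} {y} c (b₁ , b₂ , b₃ , refl) = b₁ , b₂ , b₃ ++ c , (begin
    (b₁ ++ x ∷ b₂ ++ y ∷ b₃) ++ c     ≡⟨ ++-assoc b₁ (x ∷ b₂ ++ y ∷ b₃) c ⟩
    b₁ ++ x ∷ (b₂ ++ y ∷ b₃) ++ c     ≡⟨ cong (λ l → b₁ ++ x ∷ l) (++-assoc b₂ (y ∷ b₃) c) ⟩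
    b₁ ++ x ∷ b₂ ++ y ∷ b₃ ++ c       ∎)
  where open ≡-Reasoning

∈⇒≺ : ∀ {x y} b c → x ∈ b → x ≺[ b ++ y ∷ c ] y
∈⇒≺ {x} {y} b c x∈b with b₁ , b₂ , refl ← ∈-∃++ x∈b = b₁ , b₂ , c , ++-assoc b₁ (x ∷ b₂) (y ∷ c)

∈⇒≻ : ∀ xs {x y ys} → x ∈ ys → y ≺[ xs ++ y ∷ ys ] x
∈⇒≻ xs x∈ys with ys₁ , ys₂ , refl ← ∈-∃++ x∈ys = xs , ys₁ , ys₂ , refl

≺⇒∈ : ∀ {x y} b c → Unique (b ++ y ∷ c) → x ≺[ b ++ y ∷ c ] y → x ∈ b
≺⇒∈ {x} {y} b c b! (b₁ , b₂ , b₃ , eq) = subst (x ∈_) (sym b≡) (∈-++⁺ʳ b₁ (here refl))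
  where
  eq′ : b ++ y ∷ c ≡ (b₁ ++ x ∷ b₂) ++ y ∷ b₃
  eq′ = trans eq (sym (++-assoc b₁ (x ∷ b₂) (y ∷ b₃)))
  b≡ : b ≡ b₁ ++ x ∷ b₂
  b≡ = ++-∷-cancelˡ b _ (Unique-++∷⇒∉ b b!) (Unique-++∷⇒∉ _ (subst Unique eq′ b!)) eq′

≺-prefix : ∀ {x y} b c → Unique (b ++ c) → x ≺[ b ++ c ] y → y ∈ b → x ≺[ b ] y
≺-prefix {x} {y} b c b! x≺y y∈b with b₁ , b₂ , refl ← ∈-∃++ y∈b =
  ∈⇒≺ b₁ b₂ (≺⇒∈ b₁ (b₂ ++ c) (subst Unique assoc b!) (subst (λ l → x ≺[ l ] y) assoc x≺y))
  where
  assoc : (b₁ ++ y ∷ b₂) ++ c ≡ b₁ ++ y ∷ b₂ ++ c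
  assoc = ++-assoc b₁ (y ∷ b₂) c

≺-trichotomy : ∀ {x y} b → x ∈ b → y ∈ b → x ≡ y ⊎ x ≺[ b ] y ⊎ y ≺[ b ] x
≺-trichotomy (w ∷ b) (here refl) (here refl) = inj₁ refl
≺-trichotomy (w ∷ b) (here refl) (there y∈b) = inj₂ (inj₁ (∈⇒≻ [] y∈b))
≺-trichotomy (w ∷ b) (there x∈b) (here refl) = inj₂ (inj₂ (∈⇒≻ [] x∈b))
≺-trichotomy (w ∷ b) (there x∈b) (there y∈b) with ≺-trichotomy b x∈b y∈b
... | inj₁ x≡y        = inj₁ x≡y
... | inj₂ (inj₁ x≺y) = inj₂ (inj₁ (≺-∷ w x≺y))
... | inj₂ (inj₂ y≺x) = inj₂ (inj₂ (≺-∷ w y≺x))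

module _ {P : Event → Set} (P? : Decidable P) where

  ≺-filter⁺ : ∀ {b x y} → x ≺[ b ] y → P x → P y → x ≺[ filter P? b ] y
  ≺-filter⁺ {x = x} {y} (b₁ , b₂ , b₃ , refl) Px Py =
    filter P? b₁ , filter P? b₂ , filter P? b₃ , (begin
      filter P? (b₁ ++ x ∷ b₂ ++ y ∷ b₃)                ≡⟨ filter-++ P? b₁ _ ⟩
      filter P? b₁ ++ filter P? (x ∷ b₂ ++ y ∷ b₃)      ≡⟨ cong (filter P? b₁ ++_) (filter-accept P? Px) ⟩
      filter P? b₁ ++ x ∷ filter P? (b₂ ++ y ∷ b₃)      ≡⟨ cong (λ l → filter P? b₁ ++ x ∷ l) (filter-++ P? b₂ _) ⟩
      filter P? b₁ ++ x ∷ filter P? b₂ ++ filter P? (y ∷ b₃)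
        ≡⟨ cong (λ l → filter P? b₁ ++ x ∷ filter P? b₂ ++ l) (filter-accept P? Py) ⟩
      filter P? b₁ ++ x ∷ filter P? b₂ ++ y ∷ filter P? b₃ ∎)
    where open ≡-Reasoning

  filter≡++∷ : ∀ b {l y r} → filter P? b ≡ l ++ y ∷ r →
               ∃₂ λ b₁ b₂ → b ≡ b₁ ++ y ∷ b₂ × filter P? b₂ ≡ r
  filter≡++∷ [] {[]}    ()
  filter≡++∷ [] {_ ∷ _} ()
  filter≡++∷ (w ∷ b) {l} eq with does (P? w) | l
  ... | true  | []     with refl , eq′ ← ∷-injective eq = [] , b , refl , eq′
  ... | true  | _ ∷ l′ with refl , eq′ ← ∷-injective eq with b₁ , b₂ , refl , eq₂ ← filter≡++∷ b eq′ =
    w ∷ b₁ , b₂ , refl , eq₂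
  ... | false | _      with b₁ , b₂ , refl , eq₂ ← filter≡++∷ b eq = w ∷ b₁ , b₂ , refl , eq₂

  ≺-filter⁻ : ∀ b {x y} → x ≺[ filter P? b ] y → x ≺[ b ] y
  ≺-filter⁻ b (_ , _ , _ , eq) with b₁ , b₂ , refl , eq₂ ← filter≡++∷ b eq
                               with b₂₁ , b₂₂ , refl , _ ← filter≡++∷ b₂ eq₂ = b₁ , b₂₁ , b₂₂ , refl

-- The pending queue and legality

serve : List Event → Event → List Event
serve Q (enq u x) = Q ∷ʳ enq u x
serve Q (deq _ _) = drop 1 Q

pending : Behavior → List Event
pending = foldl serve []

isEnq? : Decidable (λ e → isEnq e ≡ true)
isEnq? e = isEnq e ≟ᵇ true

enqs : Behavior → Behavior
enqs = filter isEnq?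

∈-foldl-serve : ∀ Q b {e} → e ∈ foldl serve Q b → e ∈ Q ⊎ e ∈ enqs b
∈-foldl-serve Q       []              e∈Q = inj₁ e∈Q
∈-foldl-serve Q       (enq u x ∷ b) e∈ with ∈-foldl-serve (Q ∷ʳ enq u x) b e∈
... | inj₂ e∈b = inj₂ (there e∈b)
... | inj₁ e∈Q′ with ∈-++⁻ Q e∈Q′
...   | inj₁ e∈Q        = inj₁ e∈Q
...   | inj₂ (here refl) = inj₂ (here refl)
∈-foldl-serve []      (deq u r ∷ b) e∈ = ∈-foldl-serve [] b e∈
∈-foldl-serve (h ∷ t) (deq u r ∷ b) e∈ with ∈-foldl-serve t b e∈
... | inj₁ e∈t = inj₁ (there e∈t)
... | inj₂ e∈b = inj₂ e∈b

∈-pending : ∀ b {e} → e ∈ pending b → e ∈ b × isEnq e ≡ true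
∈-pending b e∈ with ∈-foldl-serve [] b e∈
... | inj₂ e∈enqs = ∈-filter⁻ isEnq? e∈enqs

head≡just⇒∈ : ∀ {A : Set} (xs : List A) {x} → head xs ≡ just x → x ∈ xs
head≡just⇒∈ (x ∷ _) refl = here refl

-- Only meaningful on enqueue events, which are all that pending queues contain.
enqValue : Event → ℕ
enqValue (enq _ x) = x
enqValue (deq _ _) = 0

Val-enq : ∀ {e} → isEnq e ≡ true → Val e ≡ just (enqValue e)
Val-enq {enq _ _} _ = refl

state : List Event → List ℕ
state = map enqValue

AtDequeues : (Event → List Event → Set) → List Event → Behavior → Set
AtDequeues P Q b = ∀ b₁ d c → b ≡ b₁ ++ d ∷ c → isDeq d ≡ true → P d (foldl serve Q b₁)

atDequeues-[] : ∀ {P Q} → AtDequeues P Q []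
atDequeues-[] []      _ _ ()
atDequeues-[] (_ ∷ _) _ _ ()

atDequeues-∷ : ∀ {P Q z} b → AtDequeues P Q (z ∷ b) → AtDequeues P (serve Q z) b
atDequeues-∷ b H b₁ d c refl = H (_ ∷ b₁) d c refl

atDequeues-++ˡ : ∀ {P Q} b c → AtDequeues P Q (b ++ c) → AtDequeues P Q b
atDequeues-++ˡ _ c H b₁ d c′ refl = H b₁ d (c′ ++ c) (++-assoc b₁ (d ∷ c′) c)

atDequeues-∷ʳ : ∀ {P Q z} b → AtDequeues P Q b → (isDeq z ≡ true → P z (foldl serve Q b)) →
                AtDequeues P Q (b ∷ʳ z)
atDequeues-∷ʳ b H Hz b₁ d c eq with ∷ʳ-≡-++∷ b b₁ eq
... | inj₁ (refl , refl) = Hz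
... | inj₂ (c′ , b≡)     = H b₁ d c′ b≡

ReturnsHead : Event → List Event → Set
ReturnsHead d Q = Val d ≡ Maybe.map enqValue (head Q)

step-serve : ∀ Q {z q} → Step (state Q) z q → q ≡ state (serve Q z)
step-serve Q       {enq u x} step-enq = sym (map-++ enqValue Q [ enq u x ])
step-serve []      step-deqNull        = refl
step-serve (_ ∷ _) step-deq            = refl

step⇒returnsHead : ∀ Q {z q} → Step (state Q) z q → isDeq z ≡ true → ReturnsHead z Q
step⇒returnsHead []      step-deqNull _ = refl
step⇒returnsHead (_ ∷ _) step-deq     _ = refl

returnsHead⇒step : ∀ Q z → (isDeq z ≡ true → ReturnsHead z Q) → Step (state Q) z (state (serve Q z))
returnsHead⇒step Q       (enq u x) _ =
  subst (Step (state Q) (enq u x)) (sym (map-++ enqValue Q [ enq u x ])) step-enq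
returnsHead⇒step []      (deq u r) H with refl ← H refl = step-deqNull
returnsHead⇒step (_ ∷ _) (deq u r) H with refl ← H refl = step-deq

run⇒returnsHead : ∀ Q {b q} → Run (state Q) b q → AtDequeues ReturnsHead Q b
run⇒returnsHead Q (next s _) []       d c refl isDeq-d = step⇒returnsHead Q s isDeq-d
run⇒returnsHead Q (next s r) (z ∷ b₁) d c refl isDeq-d =
  run⇒returnsHead (serve Q z) (subst (λ q → Run q _ _) (step-serve Q s) r) b₁ d c refl isDeq-d

returnsHead⇒run : ∀ Q b → AtDequeues ReturnsHead Q b → Run (state Q) b (state (foldl serve Q b))
returnsHead⇒run Q []      _ = done
returnsHead⇒run Q (z ∷ b) H =
  next (returnsHead⇒step Q z (H [] z b refl)) (returnsHead⇒run (serve Q z) b (atDequeues-∷ {ReturnsHead} b H))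

legal⇔returnsHead : ∀ b → Legal b ⇔ AtDequeues ReturnsHead [] b
legal⇔returnsHead b = mk⇔ (λ (_ , run) → run⇒returnsHead [] run) (λ H → _ , returnsHead⇒run [] b H)

-- Canonical matchings

Matching : Set
Matching = Event → Maybe Event

ServesHead : Matching → Event → List Event → Set
ServesHead μ d Q = μ d ≡ head Q

Canonical : Matching → Behavior → Set
Canonical μ = AtDequeues (ServesHead μ) []

Matched : Matching → Behavior → Event → Set
Matched μ b e = ∃[ d ] (d ∈ b × isDeq d ≡ true × μ d ≡ just e)

Matched-++ : ∀ {μ b e} c → Matched μ b e → Matched μ (b ++ c) e
Matched-++ c (d , d∈b , isDeq-d , μd≡e) = d , ∈-++⁺ˡ d∈b , isDeq-d , μd≡e

canonical-≺ : ∀ {μ b d e} → Canonical μ b → d ∈ b → isDeq d ≡ true → μ d ≡ just e →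
              e ≺[ b ] d × isEnq e ≡ true
canonical-≺ {μ} {d = d} {e} can d∈b isDeq-d μd≡e with b₁ , c , refl ← ∈-∃++ d∈b =
  map₁ (∈⇒≺ b₁ c) (∈-pending b₁ e∈pending)
  where
  e∈pending : e ∈ pending b₁
  e∈pending = head≡just⇒∈ (pending b₁) (trans (sym (can b₁ d c refl isDeq-d)) μd≡e)

count : (Event → Bool) → Behavior → ℕ
count f b = length (filter (λ e → f e ≟ᵇ true) b)

count-++ : ∀ f b c → count f (b ++ c) ≡ count f b + count f c
count-++ f b c =
  trans (cong length (filter-++ (λ e → f e ≟ᵇ true) b c)) (length-++ (filter (λ e → f e ≟ᵇ true) b))

isMatchedDeq : Matching → Event → Bool
isMatchedDeq μ d = isDeq d ∧ is-just (μ d)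

-- Q is the queue after b: the enqueues of b not (yet) served by μ.
record QueueInvariant (μ : Matching) (b : Behavior) (Q : List Event) : Set where
  field
    served            : List Event
    enqs≡served++Q    : enqs b ≡ served ++ Q
    served-matched    : All (Matched μ b) served
    pending-unmatched : All (¬_ ∘ Matched μ b) Q
    count-balance     : count isEnq b ≡ count (isMatchedDeq μ) b + length Q

Matched-∷ʳ-enq⁻ : ∀ {μ b y u x} → Matched μ (b ∷ʳ enq u x) y → Matched μ b y
Matched-∷ʳ-enq⁻ {b = b} (d , d∈ , isDeq-d , μd≡y) with ∈-++⁻ b d∈
... | inj₁ d∈b        = d , d∈b , isDeq-d , μd≡y
... | inj₂ (here refl) with () ← isDeq-d

invariant-enq : ∀ {μ b Q u x} → enq u x ∉ b → Canonical μ b → QueueInvariant μ b Q →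
                QueueInvariant μ (b ∷ʳ enq u x) (Q ∷ʳ enq u x)
invariant-enq {μ} {b} {Q} {u} {x} e∉b can I = record
  { served            = served
  ; enqs≡served++Q    = begin
      enqs (b ∷ʳ e)         ≡⟨ filter-++ isEnq? b [ e ] ⟩
      enqs b ∷ʳ e           ≡⟨ cong (_∷ʳ e) enqs≡served++Q ⟩
      (served ++ Q) ∷ʳ e    ≡⟨ ++-assoc served Q [ e ] ⟩
      served ++ Q ∷ʳ e      ∎
  ; served-matched    = All.map (Matched-++ [ e ]) served-matched
  ; pending-unmatched = ++⁺ (All.map (_∘ Matched-∷ʳ-enq⁻) pending-unmatched) (e-unmatched ∘ Matched-∷ʳ-enq⁻ ∷ [])
  ; count-balance     = begin
      count isEnq (b ∷ʳ e)                            ≡⟨ count-++ isEnq b [ e ] ⟩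
      count isEnq b + 1                               ≡⟨ cong (_+ 1) count-balance ⟩
      count (isMatchedDeq μ) b + length Q + 1         ≡⟨ +-assoc (count (isMatchedDeq μ) b) (length Q) 1 ⟩
      count (isMatchedDeq μ) b + (length Q + 1)       ≡⟨ cong₂ _+_ (sym (+-identityʳ _)) (sym (length-++ Q)) ⟩
      count (isMatchedDeq μ) b + 0 + length (Q ∷ʳ e)
        ≡⟨ cong (_+ length (Q ∷ʳ e)) (sym (count-++ (isMatchedDeq μ) b [ e ])) ⟩
      count (isMatchedDeq μ) (b ∷ʳ e) + length (Q ∷ʳ e) ∎
  }
  where
  open QueueInvariant I
  open ≡-Reasoning
  e : Event
  e = enq u x
  e-unmatched : ¬ Matched μ b e
  e-unmatched (d , d∈b , isDeq-d , μd≡e) = e∉b (≺⇒∈ˡ (proj₁ (canonical-≺ can d∈b isDeq-d μd≡e)))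

count-served-deq : ∀ {μ u r} Q → μ (deq u r) ≡ head Q →
                   count (isMatchedDeq μ) [ deq u r ] + length (drop 1 Q) ≡ length Q
count-served-deq []      μz≡ rewrite μz≡ = refl
count-served-deq (_ ∷ _) μz≡ rewrite μz≡ = refl

invariant-deq : ∀ {μ b Q u r} → Unique Q → μ (deq u r) ≡ head Q → QueueInvariant μ b Q →
                QueueInvariant μ (b ∷ʳ deq u r) (drop 1 Q)
invariant-deq {μ} {b} {Q} {u} {r} Q! μz≡ I = record
  { served            = served ++ take 1 Q
  ; enqs≡served++Q    = begin
      enqs (b ∷ʳ z)                  ≡⟨ filter-++ isEnq? b [ z ] ⟩
      enqs b ++ []                   ≡⟨ ++-identityʳ (enqs b) ⟩
      enqs b                         ≡⟨ enqs≡served++Q ⟩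
      served ++ Q                    ≡⟨ cong (served ++_) (sym (take++drop≡id 1 Q)) ⟩
      served ++ take 1 Q ++ drop 1 Q ≡⟨ ++-assoc served (take 1 Q) (drop 1 Q) ⟨
      (served ++ take 1 Q) ++ drop 1 Q ∎
  ; served-matched    = ++⁺ (All.map (Matched-++ [ z ]) served-matched) (head-matched Q μz≡)
  ; pending-unmatched = tail-unmatched Q Q! μz≡ pending-unmatched
  ; count-balance     = begin
      count isEnq (b ∷ʳ z)                     ≡⟨ count-++ isEnq b [ z ] ⟩
      count isEnq b + 0                        ≡⟨ +-identityʳ _ ⟩
      count isEnq b                            ≡⟨ count-balance ⟩
      M b + length Q                           ≡⟨ cong (M b +_) (count-served-deq {μ} Q μz≡) ⟨
      M b + (M [ z ] + length (drop 1 Q))      ≡⟨ +-assoc (M b) (M [ z ]) _ ⟨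
      M b + M [ z ] + length (drop 1 Q)        ≡⟨ cong (_+ length (drop 1 Q)) (count-++ (isMatchedDeq μ) b [ z ]) ⟨
      M (b ∷ʳ z) + length (drop 1 Q)           ∎
  }
  where
  open QueueInvariant I
  open ≡-Reasoning
  z : Event
  z = deq u r
  M : Behavior → ℕ
  M = count (isMatchedDeq μ)
  head-matched : ∀ Q → μ z ≡ head Q → All (Matched μ (b ∷ʳ z)) (take 1 Q)
  head-matched []      _    = []
  head-matched (h ∷ _) μz≡h = (z , ∈-++⁺ʳ b (here refl) , refl , μz≡h) ∷ []
  tail-unmatched : ∀ Q → Unique Q → μ z ≡ head Q → All (¬_ ∘ Matched μ b) Q →
                   All (¬_ ∘ Matched μ (b ∷ʳ z)) (drop 1 Q)
  tail-unmatched []      _         _    _                 = []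
  tail-unmatched (h ∷ t) (h∉t ∷ _) μz≡h (_ ∷ t-unmatched) = All.tabulate unmatched
    where
    unmatched : ∀ {y} → y ∈ t → ¬ Matched μ (b ∷ʳ z) y
    unmatched {y} y∈t (d , d∈ , isDeq-d , μd≡y) with ∈-++⁻ b d∈
    ... | inj₁ d∈b        = All.lookup t-unmatched y∈t (d , d∈b , isDeq-d , μd≡y)
    ... | inj₂ (here refl) = All.lookup h∉t y∈t (just-injective (trans (sym μz≡h) μd≡y))

queue-unique : ∀ {μ b Q} → Unique b → QueueInvariant μ b Q → Unique Q
queue-unique {b = b} b! I = Unique-++⁻ʳ served (subst Unique enqs≡served++Q (filter⁺ isEnq? b!))
  where open QueueInvariant I

invariant-∷ʳ : ∀ {μ Q} b z → Unique (b ∷ʳ z) → Canonical μ b → (isDeq z ≡ true → μ z ≡ head Q) →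
               QueueInvariant μ b Q → QueueInvariant μ (b ∷ʳ z) (serve Q z)
invariant-∷ʳ b (enq u x) b! can _   I = invariant-enq (Unique-++∷⇒∉ b b!) can I
invariant-∷ʳ b (deq u r) b! _   μz≡ I = invariant-deq (queue-unique (Unique-++⁻ˡ b b!) I) (μz≡ refl) I

canonical⇒invariant : ∀ {μ} b → Unique b → Canonical μ b → QueueInvariant μ b (pending b)
canonical⇒invariant {μ} b = go (reverseView b)
  where
  go : ∀ {b} → Reverse b → Unique b → Canonical μ b → QueueInvariant μ b (pending b)
  go []             _  _   = record
    { served = [] ; enqs≡served++Q = refl ; served-matched = [] ; pending-unmatched = [] ; count-balance = refl }
  go (b ∶ rb ∶ʳ z) b! can = subst (QueueInvariant μ (b ∷ʳ z)) (sym (foldl-++ serve [] b [ z ]))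
    (invariant-∷ʳ b z b! can-b (can b z [] refl) (go rb (Unique-++⁻ˡ b b!) can-b))
    where
    can-b : Canonical μ b
    can-b = atDequeues-++ˡ {ServesHead μ} b [ z ] can

head-unmatched : ∀ {μ b Q e} → QueueInvariant μ b Q → head Q ≡ just e → ¬ Matched μ b e
head-unmatched {Q = Q} I h≡e = All.lookup (QueueInvariant.pending-unmatched I) (head≡just⇒∈ Q h≡e)

empty-balance : ∀ {μ b Q} → QueueInvariant μ b Q → head Q ≡ nothing → count isEnq b ≡ count (isMatchedDeq μ) b
empty-balance {Q = []} I _ = trans (QueueInvariant.count-balance I) (+-identityʳ _)

before-head-served : ∀ {μ b Q e h} → Unique b → QueueInvariant μ b Q → head Q ≡ just h →
                     isEnq e ≡ true → e ≺[ b ] h → Matched μ b e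
before-head-served {b = b} {h ∷ t} {e} {h} b! I refl isEnq-e e≺h =
  All.lookup served-matched (≺⇒∈ served t enqs! e≺h′)
  where
  open QueueInvariant I
  enqs! : Unique (served ++ h ∷ t)
  enqs! = subst Unique enqs≡served++Q (filter⁺ isEnq? b!)
  isEnq-h : isEnq h ≡ true
  isEnq-h = proj₂ (∈-filter⁻ isEnq? {xs = b} (subst (h ∈_) (sym enqs≡served++Q) (∈-++⁺ʳ served (here refl))))
  e≺h′ : e ≺[ served ++ h ∷ t ] h
  e≺h′ = subst (λ l → e ≺[ l ] h) enqs≡served++Q (≺-filter⁺ isEnq? e≺h isEnq-e isEnq-h)

map≡nothing⇒≡nothing : ∀ {A C : Set} {f : A → C} m → Maybe.map f m ≡ nothing → m ≡ nothing
map≡nothing⇒≡nothing nothing _ = refl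

module _ {μ : Matching} {B : Behavior} (B! : Unique B) (can : Canonical μ B) where

  prefix-invariant : ∀ b c → B ≡ b ++ c → QueueInvariant μ b (pending b)
  prefix-invariant b c eq =
    canonical⇒invariant b (Unique-++⁻ˡ b (subst Unique eq B!))
      (atDequeues-++ˡ {ServesHead μ} b c (subst (Canonical μ) eq can))

  -- Once served, e is no longer pending at any later dequeue.
  canonical-injective : ∀ {d d′ e} → isDeq d ≡ true → d′ ∈ B → isDeq d′ ≡ true →
                        d ≺[ B ] d′ → μ d ≡ just e → μ d′ ≡ just e → ⊥
  canonical-injective {d} {d′} isDeq-d d′∈B isDeq-d′ d≺d′ μd≡e μd′≡e with b , c , eq ← ∈-∃++ d′∈B =
    head-unmatched (prefix-invariant b (d′ ∷ c) eq) (trans (sym (can b d′ c eq isDeq-d′)) μd′≡e)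
      (d , ≺⇒∈ b c (subst Unique eq B!) (subst (λ l → d ≺[ l ] d′) eq d≺d′) , isDeq-d , μd≡e)

  served-before : ∀ b c {d′ e e′} → B ≡ b ++ d′ ∷ c → isDeq d′ ≡ true → μ d′ ≡ just e′ →
                  isEnq e ≡ true → e ≺[ B ] e′ → Matched μ b e
  served-before b c {d′} {e} {e′} eq isDeq-d′ μd′≡e′ isEnq-e e≺e′ =
    before-head-served (Unique-++⁻ˡ b B!′) (prefix-invariant b (d′ ∷ c) eq) head≡e′ isEnq-e
      (≺-prefix b (d′ ∷ c) B!′ (subst (λ l → e ≺[ l ] e′) eq e≺e′) e′∈b)
    where
    B!′ : Unique (b ++ d′ ∷ c)
    B!′ = subst Unique eq B!
    head≡e′ : head (pending b) ≡ just e′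
    head≡e′ = trans (sym (can b d′ c eq isDeq-d′)) μd′≡e′
    e′∈b : e′ ∈ b
    e′∈b = proj₁ (∈-pending b (head≡just⇒∈ (pending b) head≡e′))

  canonical⇒witness : AtDequeues ReturnsHead [] B → SequentialWitness B μ
  canonical⇒witness returnsHead = record
    { into  = λ d e d∈B isDeq-d μd≡e → map₁ ≺⇒∈ˡ (canonical-≺ can d∈B isDeq-d μd≡e)
    ; w-i   = λ d e d∈B isDeq-d μd≡e → begin
        Val d                        ≡⟨ values-agree d∈B isDeq-d ⟩
        Maybe.map enqValue (μ d)     ≡⟨ cong (Maybe.map enqValue) μd≡e ⟩
        just (enqValue e)            ≡⟨ Val-enq (proj₂ (canonical-≺ can d∈B isDeq-d μd≡e)) ⟨
        Val e                        ∎
    ; w-ii  = λ d d∈B isDeq-d → mk⇔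
        (λ μd≡nothing → trans (values-agree d∈B isDeq-d) (cong (Maybe.map enqValue) μd≡nothing))
        (λ Vd≡nothing → map≡nothing⇒≡nothing (μ d) (trans (sym (values-agree d∈B isDeq-d)) Vd≡nothing))
    ; w-iii = injective
    ; w-iv  = λ d e d∈B isDeq-d μd≡e → proj₁ (canonical-≺ can d∈B isDeq-d μd≡e)
    ; w-v   = fifo
    ; w-vi  = λ d b c isDeq-d eq μd≡nothing →
        empty-balance (prefix-invariant b (d ∷ c) eq) (trans (sym (can b d c eq isDeq-d)) μd≡nothing)
    }
    where
    open ≡-Reasoning

    values-agree : ∀ {d} → d ∈ B → isDeq d ≡ true → Val d ≡ Maybe.map enqValue (μ d)
    values-agree {d} d∈B isDeq-d with b , c , eq ← ∈-∃++ d∈B =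
      trans (returnsHead b d c eq isDeq-d) (cong (Maybe.map enqValue) (sym (can b d c eq isDeq-d)))

    injective : ∀ d d′ e → d ∈ B → isDeq d ≡ true → d′ ∈ B → isDeq d′ ≡ true →
                μ d ≡ just e → μ d′ ≡ just e → d ≡ d′
    injective d d′ e d∈B isDeq-d d′∈B isDeq-d′ μd≡e μd′≡e with ≺-trichotomy B d∈B d′∈B
    ... | inj₁ d≡d′        = d≡d′
    ... | inj₂ (inj₁ d≺d′) = ⊥-elim (canonical-injective isDeq-d d′∈B isDeq-d′ d≺d′ μd≡e μd′≡e)
    ... | inj₂ (inj₂ d′≺d) = ⊥-elim (canonical-injective isDeq-d′ d∈B isDeq-d d′≺d μd′≡e μd≡e)

    fifo : ∀ e d′ e′ → e ∈ B → isEnq e ≡ true → d′ ∈ B → isDeq d′ ≡ true → μ d′ ≡ just e′ → e ≺[ B ] e′ →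
           ∃[ d ] (d ∈ B × isDeq d ≡ true × μ d ≡ just e × d ≺[ B ] d′)
    fifo e d′ e′ _ isEnq-e d′∈B isDeq-d′ μd′≡e′ e≺e′
      with b , c , eq ← ∈-∃++ d′∈B
      with d , d∈b , isDeq-d , μd≡e ← served-before b c eq isDeq-d′ μd′≡e′ isEnq-e e≺e′ =
      d , subst (d ∈_) (sym eq) (∈-++⁺ˡ d∈b) , isDeq-d , μd≡e , subst (λ l → d ≺[ l ] d′) (sym eq) (∈⇒≺ b c d∈b)

-- Sequential witnesses are canonical

module _ {μ : Matching} {b : Behavior} {z : Event} {c : Behavior}
         (B! : Unique (b ++ z ∷ c)) (W : SequentialWitness (b ++ z ∷ c) μ) (isDeq-z : isDeq z ≡ true) where
  open SequentialWitness W

  private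
    z∈B : z ∈ b ++ z ∷ c
    z∈B = ∈-++⁺ʳ b (here refl)

  served-not-again : ∀ {e} → Matched μ b e → μ z ≡ just e → ⊥
  served-not-again {e} (d , d∈b , isDeq-d , μd≡e) μz≡e =
    Unique-++∷⇒∉ b B! (subst (_∈ b) (w-iii d z e (∈-++⁺ˡ d∈b) isDeq-d z∈B isDeq-z μd≡e μz≡e) d∈b)

  queued : ∀ {Q e} → QueueInvariant μ b Q → μ z ≡ just e → e ∈ Q
  queued {Q} {e} I μz≡e =
    [ (λ e∈served → ⊥-elim (served-not-again (All.lookup served-matched e∈served) μz≡e)) , id ]′
      (∈-++⁻ served e∈served++Q)
    where
    open QueueInvariant I
    e∈b : e ∈ b
    e∈b = ≺⇒∈ b c B! (w-iv z e z∈B isDeq-z μz≡e)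
    e∈served++Q : e ∈ served ++ Q
    e∈served++Q = subst (e ∈_) enqs≡served++Q (∈-filter⁺ isEnq? e∈b (proj₂ (into z e z∈B isDeq-z μz≡e)))

  -- By FIFO, a dequeue behind the head h would force h to be served before z, but h is pending.
  not-behind-head : ∀ {h t e} → QueueInvariant μ b (h ∷ t) → e ∈ t → μ z ≡ just e → ⊥
  not-behind-head {h} {t} {e} I e∈t μz≡e =
    head-unmatched I refl
      (matched-before-z (w-v h z e (∈-++⁺ˡ h∈b) isEnq-h z∈B isDeq-z μz≡e (≺-++ʳ (z ∷ c) h≺e)))
    where
    open QueueInvariant I
    h∈enqs : h ∈ enqs b
    h∈enqs = subst (h ∈_) (sym enqs≡served++Q) (∈-++⁺ʳ served (here refl))
    h∈b : h ∈ b
    h∈b = proj₁ (∈-filter⁻ isEnq? h∈enqs)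
    isEnq-h : isEnq h ≡ true
    isEnq-h = proj₂ (∈-filter⁻ isEnq? {xs = b} h∈enqs)
    h≺e : h ≺[ b ] e
    h≺e = ≺-filter⁻ isEnq? b (subst (λ l → h ≺[ l ] e) (sym enqs≡served++Q) (∈⇒≻ served e∈t))
    matched-before-z : ∃[ d ] (d ∈ b ++ z ∷ c × isDeq d ≡ true × μ d ≡ just h × d ≺[ b ++ z ∷ c ] z) →
                       Matched μ b h
    matched-before-z (d , _ , isDeq-d , μd≡h , d≺z) = d , ≺⇒∈ b c B! d≺z , isDeq-d , μd≡h

  served⇒head : ∀ {Q e} → QueueInvariant μ b Q → μ z ≡ just e → head Q ≡ just e
  served⇒head I μz≡e with queued I μz≡e
  served⇒head {_ ∷ _} I μz≡e | here refl = refl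
  served⇒head {_ ∷ _} I μz≡e | there e∈t = ⊥-elim (not-behind-head I e∈t μz≡e)

  unserved⇒empty : ∀ {Q} → QueueInvariant μ b Q → μ z ≡ nothing → Q ≡ []
  unserved⇒empty {[]}    _ _ = refl
  unserved⇒empty {_ ∷ _} I μz≡nothing
    with () ← +-cancelˡ-≡ _ _ 0 (trans (sym (QueueInvariant.count-balance I))
                                   (trans (w-vi z b c isDeq-z refl μz≡nothing) (sym (+-identityʳ _))))

  witness-servesHead : ∀ {Q} → QueueInvariant μ b Q → μ z ≡ head Q
  witness-servesHead I with μ z in μz≡
  ... | nothing = cong head (sym (unserved⇒empty I μz≡))
  ... | just _  = sym (served⇒head I μz≡)

witness⇒canonical : ∀ {μ} B → Unique B → SequentialWitness B μ → Canonical μ B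
witness⇒canonical {μ} B B! W = go (reverseView B) [] (sym (++-identityʳ B))
  where
  go : ∀ {b} → Reverse b → ∀ c → B ≡ b ++ c → Canonical μ b
  go []             _ _  = atDequeues-[] {ServesHead μ}
  go (b ∶ rb ∶ʳ z) c eq = atDequeues-∷ʳ {ServesHead μ} b can-b λ isDeq-z →
    witness-servesHead (subst Unique eq′ B!) (subst (λ l → SequentialWitness l μ) eq′ W) isDeq-z
      (canonical⇒invariant b (Unique-++⁻ˡ b (subst Unique eq′ B!)) can-b)
    where
    eq′ : B ≡ b ++ z ∷ c
    eq′ = trans eq (++-assoc b [ z ] c)
    can-b : Canonical μ b
    can-b = go rb (z ∷ c) eq′

witness-values : ∀ {μ B d} → SequentialWitness B μ → d ∈ B → isDeq d ≡ true → Val d ≡ Maybe.map enqValue (μ d)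
witness-values {μ} {d = d} W d∈B isDeq-d with μ d in μd≡
... | nothing = Equivalence.to (SequentialWitness.w-ii W d d∈B isDeq-d) μd≡
... | just e  = trans (SequentialWitness.w-i W d e d∈B isDeq-d μd≡)
                      (Val-enq (proj₂ (SequentialWitness.into W d e d∈B isDeq-d μd≡)))

witness⇒returnsHead : ∀ {μ} B → Canonical μ B → SequentialWitness B μ → AtDequeues ReturnsHead [] B
witness⇒returnsHead B can W b d c eq isDeq-d =
  trans (witness-values W (subst (d ∈_) (sym eq) (∈-++⁺ʳ b (here refl))) isDeq-d)
        (cong (Maybe.map enqValue) (can b d c eq isDeq-d))

-- Comparing identifiers instead of events suffices since they are unique in a queue behavior.
canonicalFrom : List Event → Behavior → Matching
canonicalFrom Q []      d = nothing
canonicalFrom Q (z ∷ b) d with uid z ≟ℕ uid d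
... | yes _ = head Q
... | no  _ = canonicalFrom (serve Q z) b d

canonicalFrom-at : ∀ Q b {z c} → Unique (map uid (b ++ z ∷ c)) →
                   canonicalFrom Q (b ++ z ∷ c) z ≡ head (foldl serve Q b)
canonicalFrom-at Q []      {z} _ with uid z ≟ℕ uid z
... | yes _   = refl
... | no z≢z = ⊥-elim (z≢z refl)
canonicalFrom-at Q (y ∷ b) {z} (y∉ ∷ uids!) with uid y ≟ℕ uid z
... | yes y≡z = ⊥-elim (All.lookup y∉ (∈-map⁺ uid (∈-++⁺ʳ b (here refl))) y≡z)
... | no  _   = canonicalFrom-at (serve Q y) b uids!

canonicalFrom-canonical : ∀ b → QueueBehavior b → Canonical (canonicalFrom [] b) b
canonicalFrom-canonical _ uids! b₁ _ _ refl _ = canonicalFrom-at [] b₁ uids!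

theorem3p10 : (b : Behavior) → QueueBehavior b → (Legal b ⇔ HasSequentialWitness b)
theorem3p10 b uids! = mk⇔ legal⇒witness witness⇒legal
  where
  b! : Unique b
  b! = map⁻ uids!

  legal⇒witness : Legal b → HasSequentialWitness b
  legal⇒witness legal = canonicalFrom [] b ,
    canonical⇒witness b! (canonicalFrom-canonical b uids!) (Equivalence.to (legal⇔returnsHead b) legal)

  witness⇒legal : HasSequentialWitness b → Legal b
  witness⇒legal (μ , W) =
    Equivalence.from (legal⇔returnsHead b) (witness⇒returnsHead b (witness⇒canonical b b! W) W)
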